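{- Let $N$ be an arboreal network. Then $\mathcal A(N)$ is acyclic if and only if every vertex of $N$ has outdegree at most 2 and the only vertices of $N$ with outdegree 2 are the roots of $N$.
   Context: In a digraph, a leaf is a vertex of indegree 1 and outdegree 0, a root is a vertex of indegree 0. A network on a finite set $X$ ($|X|\ge2$) is a simple acyclic digraph $N$ whose underlying undirected graph is connected, whose set of leaves is $X$, in which every vertex of indegree 0 has outdegree at least 2, every vertex of outdegree 0 has indegree 1, and no vertex has both indegree and outdegree equal to 1. $N$ is arboreal if its underlying undirected graph is a tree. $\mathcal A(N)$ is the graph on $X$ in which distinct $x,y$ are adjacent iff some vertex of $N$ has directed paths (possibly of length 0) to both. -}

module Defs where

open import Data.Nat using (ℕ; zero; suc; _+_; _≤_)
open import Data.Nat.Properties using (_≟_)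
open import Data.Fin using (Fin) renaming (zero to fzero; suc to fsuc)
open import Data.Bool using (Bool; true; false; if_then_else_; T; _∧_)
open import Data.List using (List; []; _∷_; length; _∷ʳ_)
open import Data.Product using (Σ; ∃; _×_)
open import Data.Sum using (_⊎_)
open import Function using (_∘_)
open import Relation.Nullary using (¬_; ⌊_⌋)
open import Relation.Binary.PropositionalEquality using (_≡_; _≢_)
open import Relation.Binary.Construct.Closure.ReflexiveTransitive using (Star)
open import Data.List.Relation.Unary.Linked using (Linked)
open import Data.List.Relation.Unary.Unique.Propositional using (Unique)

-- A (simple) digraph on vertex set Fin n, given by its arc relation
-- (at most one arc u → v for each ordered pair, so no multi-arcs).
Digraph : ℕ → Set
Digraph n = Fin n → Fin n → Bool

count : ∀ {n} → (Fin n → Bool) → ℕ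
count {zero}  f = 0
count {suc n} f = (if f fzero then 1 else 0) + count (f ∘ fsuc)

-- A cycle in an (undirected) graph with adjacency relation R:
-- distinct vertices x, y₁, …, yₖ with k ≥ 2 (so length ≥ 3),
-- consecutive ones adjacent and yₖ adjacent to x.
HasCycle : ∀ {n} → (Fin n → Fin n → Set) → Set
HasCycle {n} R =
  Σ (Fin n) λ x → Σ (List (Fin n)) λ ys →
    (2 ≤ length ys) × Unique (x ∷ ys) × Linked R ((x ∷ ys) ∷ʳ x)

module _ {n : ℕ} (G : Digraph n) where

  Arc : Fin n → Fin n → Set
  Arc u v = T (G u v)

  indeg : Fin n → ℕ
  indeg v = count (λ u → G u v)

  outdeg : Fin n → ℕ
  outdeg v = count (G v)

  IsLeaf : Fin n → Set
  IsLeaf v = (indeg v ≡ 1) × (outdeg v ≡ 0)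

  isLeafᵇ : Fin n → Bool
  isLeafᵇ v = ⌊ indeg v ≟ 1 ⌋ ∧ ⌊ outdeg v ≟ 0 ⌋

  numLeaves : ℕ
  numLeaves = count isLeafᵇ

  IsRoot : Fin n → Set
  IsRoot v = indeg v ≡ 0

  Reach : Fin n → Fin n → Set
  Reach = Star Arc

  UAdj : Fin n → Fin n → Set
  UAdj u v = Arc u v ⊎ Arc v u

  Loopless : Set
  Loopless = ∀ v → ¬ Arc v v

  DAcyclic : Set
  DAcyclic = ∀ u v → Arc u v → ¬ Reach v u

  UConnected : Set
  UConnected = ∀ u v → Star UAdj u v

  record IsNetwork : Set where
    field
      loopless    : Loopless
      acyclic     : DAcyclic
      connected   : UConnected
      twoLeaves   : 2 ≤ numLeaves
      rootOut     : ∀ v → indeg v ≡ 0 → 2 ≤ outdeg v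
      sinkIsLeaf  : ∀ v → outdeg v ≡ 0 → indeg v ≡ 1
      noDeg11     : ∀ v → ¬ ((indeg v ≡ 1) × (outdeg v ≡ 1))

  IsArboreal : Set
  IsArboreal = IsNetwork × UConnected × ¬ HasCycle UAdj

  -- the graph 𝒜(N) on the leaf set X (non-leaves are isolated/excluded)
  AAdj : Fin n → Fin n → Set
  AAdj x y = IsLeaf x × IsLeaf y × (x ≢ y) ×
             ∃ λ w → Reach w x × Reach w y

{-# OPTIONS --safe #-}
-- Since the underlying graph is a tree, two distinct children of a vertex
-- reach disjoint sets of vertices. If a vertex has three children, or a
-- non-root vertex has two, this yields three leaves with pairwise common
-- ancestors, i.e. a triangle in 𝒜(N); for the non-root vertex the third leaf
-- hangs off its lowest branching ancestor, which exists because roots branch.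
-- Conversely, if only roots branch and each into two, every non-root reaches
-- a single leaf, so an edge x y of 𝒜(N) comes from a root w whose only leaves
-- are x and y. Every other edge of a cycle of 𝒜(N) through x y is then
-- witnessed by an ancestor other than w, and the cycle lifts to a walk from
-- y to x avoiding w, which closes with w to a cycle of the tree.
module Submission where

open import Defs
open import Data.Nat using (ℕ; zero; suc; _+_; _≤_; z≤n; s≤s; s≤s⁻¹; _≤?_)
open import Data.Nat.Properties
  using (+-suc; ≤-trans; ≤-antisym; ≤-reflexive; ≰⇒>; <-irrefl; n≢0⇒n>0)
  renaming (_≟_ to _≟ℕ_)
open import Data.Fin using (Fin) renaming (zero to fzero; suc to fsuc)
open import Data.Fin.Properties using (_≟_)
open import Data.Fin.Induction using (spo-wellFounded; spo-noetherian)
open import Data.Bool using (Bool; true; false; if_then_else_; T)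
open import Data.Empty using (⊥-elim)
open import Data.Product using (Σ; ∃; ∃₂; _×_; _,_; proj₁; uncurry)
open import Data.Sum using (_⊎_; inj₁; inj₂) renaming (swap to ⊎-swap)
open import Function using (_∘_; flip)
open import Function.Bundles using (_⇔_; mk⇔)
open import Relation.Nullary using (¬_; ⌊_⌋; yes; no)
open import Relation.Nullary.Decidable using (decidable-stable)
open import Relation.Binary.PropositionalEquality
open import Relation.Binary.Structures using (IsStrictPartialOrder)
open import Induction.WellFounded using (Acc; acc; WellFounded)
open import Data.List using (List; []; _∷_; length; _∷ʳ_)
open import Data.List.Relation.Unary.Any using (here; there)
open import Data.List.Relation.Unary.All using (All; []; _∷_)
import Data.List.Relation.Unary.All as All
open import Data.List.Relation.Unary.All.Properties using (¬Any⇒All¬)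
open import Data.List.Relation.Unary.AllPairs using ([]; _∷_)
open import Data.List.Relation.Unary.Linked using (Linked; [-]; _∷_)
open import Data.List.Relation.Unary.Unique.Propositional using (Unique)
open import Data.List.Membership.Propositional using (_∈_)
import Data.List.Membership.DecPropositional as DecMembership
open import Relation.Binary.Construct.Closure.ReflexiveTransitive
  using (Star; ε; _◅_; _◅◅_; reverse)

infixl 6 _∖_

_∖_ : ∀ {n} → (Fin n → Bool) → Fin n → Fin n → Bool
(f ∖ j) i = if ⌊ i ≟ j ⌋ then false else f i

count-cong : ∀ {n} {f g : Fin n → Bool} → (∀ i → f i ≡ g i) → count f ≡ count g
count-cong {zero}  e = refl
count-cong {suc n} e = cong₂ _+_ (cong (λ b → if b then 1 else 0) (e fzero)) (count-cong (e ∘ fsuc))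

∖-fsuc : ∀ {n} (f : Fin (suc n) → Bool) j i → (f ∖ fsuc j) (fsuc i) ≡ ((f ∘ fsuc) ∖ j) i
∖-fsuc f j i with i ≟ j
... | yes _ = refl
... | no  _ = refl

count-∖ : ∀ {n} (f : Fin n → Bool) j → T (f j) → count f ≡ suc (count (f ∖ j))
count-∖ f fzero t with f fzero
... | true = refl
count-∖ f (fsuc j) t = begin
  b + count (f ∘ fsuc)                 ≡⟨ cong (b +_) (count-∖ (f ∘ fsuc) j t) ⟩
  b + suc (count ((f ∘ fsuc) ∖ j))     ≡⟨ +-suc b _ ⟩
  suc (b + count ((f ∘ fsuc) ∖ j))     ≡⟨ cong (suc ∘ (b +_)) (count-cong (sym ∘ ∖-fsuc f j)) ⟩
  suc (b + count ((f ∖ fsuc j) ∘ fsuc)) ∎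
  where
  open ≡-Reasoning
  b = if f fzero then 1 else 0

∖⁻ : ∀ {n} (f : Fin n → Bool) {j i} → T ((f ∖ j) i) → T (f i) × i ≢ j
∖⁻ f {j} {i} t with i ≟ j
... | no i≢j = t , i≢j

∖⁺ : ∀ {n} (f : Fin n → Bool) {j i} → T (f i) → i ≢ j → T ((f ∖ j) i)
∖⁺ f {j} {i} t i≢j with i ≟ j
... | yes i≡j = ⊥-elim (i≢j i≡j)
... | no  _   = t

≤-count-∖ : ∀ {n m} (f : Fin n → Bool) {j} → T (f j) → suc m ≤ count f → m ≤ count (f ∖ j)
≤-count-∖ f {j} t le = s≤s⁻¹ (subst (_ ≤_) (count-∖ f j t) le)

T⇒1≤count : ∀ {n} (f : Fin n → Bool) {j} → T (f j) → 1 ≤ count f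
T⇒1≤count f {j} t rewrite count-∖ f j t = s≤s z≤n

1≤count⇒∃T : ∀ {n} (f : Fin n → Bool) → 1 ≤ count f → ∃ λ i → T (f i)
1≤count⇒∃T {suc n} f le with f fzero in eq
... | true  = fzero , subst T (sym eq) _
... | false with 1≤count⇒∃T (f ∘ fsuc) le
...   | i , t = fsuc i , t

2≤count⇒∃-other : ∀ {n} (f : Fin n → Bool) {j} → T (f j) → 2 ≤ count f → ∃ λ i → T (f i) × i ≢ j
2≤count⇒∃-other f t le with 1≤count⇒∃T (f ∖ _) (≤-count-∖ f t le)
... | i , t′ = i , ∖⁻ f t′

2≤count⇒∃-distinct : ∀ {n} (f : Fin n → Bool) → 2 ≤ count f →
  ∃₂ λ i j → T (f i) × T (f j) × i ≢ j
2≤count⇒∃-distinct f le with 1≤count⇒∃T f (≤-trans (s≤s z≤n) le)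
... | i , tᵢ with 2≤count⇒∃-other f tᵢ le
...   | j , tⱼ , j≢i = i , j , tᵢ , tⱼ , j≢i ∘ sym

3≤count⇒∃-distinct : ∀ {n} (f : Fin n → Bool) → 3 ≤ count f →
  ∃₂ λ i j → ∃ λ k → T (f i) × T (f j) × T (f k) × i ≢ j × i ≢ k × j ≢ k
3≤count⇒∃-distinct f le with 1≤count⇒∃T f (≤-trans (s≤s z≤n) le)
... | i , tᵢ with 2≤count⇒∃-distinct (f ∖ i) (≤-count-∖ f tᵢ le)
...   | j , k , tⱼ , tₖ , j≢k with ∖⁻ f tⱼ | ∖⁻ f tₖ
...     | tⱼ′ , j≢i | tₖ′ , k≢i = i , j , k , tᵢ , tⱼ′ , tₖ′ , j≢i ∘ sym , k≢i ∘ sym , j≢k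

distinct-T⇒2≤count : ∀ {n} (f : Fin n → Bool) {i j} → T (f i) → T (f j) → i ≢ j → 2 ≤ count f
distinct-T⇒2≤count f {i} tᵢ tⱼ i≢j rewrite count-∖ f i tᵢ =
  s≤s (T⇒1≤count (f ∖ i) (∖⁺ f tⱼ (i≢j ∘ sym)))

distinct-T⇒3≤count : ∀ {n} (f : Fin n → Bool) {i j k} → T (f i) → T (f j) → T (f k) →
  i ≢ j → i ≢ k → j ≢ k → 3 ≤ count f
distinct-T⇒3≤count f {i} tᵢ tⱼ tₖ i≢j i≢k j≢k rewrite count-∖ f i tᵢ =
  s≤s (distinct-T⇒2≤count (f ∖ i) (∖⁺ f tⱼ (i≢j ∘ sym)) (∖⁺ f tₖ (i≢k ∘ sym)) j≢k)

module Walks {n : ℕ} {R : Fin n → Fin n → Set} where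
  open DecMembership (_≟_ {n = n}) using (_∈?_)

  -- Splitting off the head makes vertices s reduce to a ∷ _ for a neutral walk s.
  successors : ∀ {a b} → Star R a b → List (Fin n)
  successors ε = []
  successors (_◅_ {j = b} _ s) = b ∷ successors s

  vertices : ∀ {a b} → Star R a b → List (Fin n)
  vertices {a} s = a ∷ successors s

  suffix : ∀ {b u} (s : Star R b u) → Unique (vertices s) →
    ∀ {a} → a ∈ vertices s → Σ (Star R a u) (λ s′ → Unique (vertices s′))
  suffix s       uq       (here refl) = s , uq
  suffix (_ ◅ s) (_ ∷ uq) (there a∈s) = suffix s uq a∈s

  simplify : ∀ {a u} → Star R a u → Σ (Star R a u) (λ s → Unique (vertices s))
  simplify ε = ε , [] ∷ []
  simplify {a} (r ◅ s) with simplify s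
  ... | s′ , uq with a ∈? vertices s′
  ...   | yes a∈s′ = suffix s′ uq a∈s′
  ...   | no  a∉s′ = r ◅ s′ , ¬Any⇒All¬ _ a∉s′ ∷ uq

  2≤length-vertices : ∀ {a u} (s : Star R a u) → a ≢ u → 2 ≤ length (vertices s)
  2≤length-vertices ε       a≢a = ⊥-elim (a≢a refl)
  2≤length-vertices (_ ◅ _) _   = s≤s (s≤s z≤n)

  vertices-linked : ∀ {S : Fin n → Fin n → Set} → (∀ {x y} → R x y → S x y) →
    ∀ {a u v} (s : Star R a u) → S u v → Linked S (vertices s ∷ʳ v)
  vertices-linked R⇒S ε       uv = uv ∷ [-]
  vertices-linked R⇒S (r ◅ s) uv = R⇒S r ∷ vertices-linked R⇒S s uv

open Walks using (vertices)

Avoiding : ∀ {n} → (Fin n → Fin n → Set) → Fin n → Fin n → Fin n → Set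
Avoiding R v x y = R x y × x ≢ v × y ≢ v

vertices-avoid : ∀ {n} {R : Fin n → Fin n → Set} {v a u} (s : Star (Avoiding R v) a u) →
  a ≢ v → All (v ≢_) (vertices s)
vertices-avoid ε                   a≢v = a≢v ∘ sym ∷ []
vertices-avoid ((_ , _ , b≢v) ◅ s) a≢v = a≢v ∘ sym ∷ vertices-avoid s b≢v

cycle-through : ∀ {n} {R : Fin n → Fin n → Set} {v a u} → R v a → R u v → a ≢ u → a ≢ v →
  Star (Avoiding R v) a u → HasCycle R
cycle-through {v = v} va uv a≢u a≢v s with Walks.simplify s
... | s′ , uq =
  v , vertices s′ , Walks.2≤length-vertices s′ a≢u , vertices-avoid s′ a≢v ∷ uq ,
  va ∷ Walks.vertices-linked proj₁ s′ uv

triangle : ∀ {n} {R : Fin n → Fin n → Set} {x y z} → R x y → R y z → R z x →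
  x ≢ y → x ≢ z → y ≢ z → HasCycle R
triangle xy yz zx x≢y x≢z y≢z =
  _ , _ ∷ _ ∷ [] , s≤s (s≤s z≤n) , (x≢y ∷ x≢z ∷ []) ∷ (y≢z ∷ []) ∷ [] ∷ [] , xy ∷ yz ∷ zx ∷ [-]

linked⇒star : ∀ {n} {R S : Fin n → Fin n → Set} {P : Fin n → Set} →
  (∀ {x y} → P x → R x y → Star S x y) →
  ∀ {x} zs {y} → All P (x ∷ zs) → Linked R (x ∷ (zs ∷ʳ y)) → Star S x y
linked⇒star step []       (px ∷ [])  (xy ∷ [-]) = step px xy
linked⇒star step (z ∷ zs) (px ∷ pzs) (xz ∷ l)   = step px xz ◅◅ linked⇒star step zs pzs l

module Network {n : ℕ} (G : Digraph n) (net : IsNetwork G) where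
  open IsNetwork net

  IsSink : Fin n → Set
  IsSink v = outdeg G v ≡ 0

  ProperDescendant : Fin n → Fin n → Set
  ProperDescendant y x = ∃ λ z → Arc G x z × Reach G z y

  properDescendant-isStrictPartialOrder : IsStrictPartialOrder _≡_ ProperDescendant
  properDescendant-isStrictPartialOrder = record
    { isEquivalence = isEquivalence
    ; irrefl        = λ { refl (z , xz , zx) → acyclic _ z xz zx }
    ; trans         = λ { (z , jz , zi) (z′ , kz′ , z′j) → z′ , kz′ , (z′j ◅◅ (jz ◅ zi)) }
    ; <-resp-≈      = (λ { refl d → d }) , (λ { refl d → d })
    }

  descendants-wellFounded : WellFounded ProperDescendant
  descendants-wellFounded = spo-wellFounded properDescendant-isStrictPartialOrder

  ancestors-wellFounded : WellFounded (flip ProperDescendant)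
  ancestors-wellFounded = spo-noetherian properDescendant-isStrictPartialOrder

  Arc⇒≢ : ∀ {u v} → Arc G u v → v ≢ u
  Arc⇒≢ {u} uv refl = loopless u uv

  Arc⇒nonroot : ∀ {u v} → Arc G u v → ¬ IsRoot G v
  Arc⇒nonroot {u} {v} uv root = <-irrefl refl (subst (1 ≤_) root (T⇒1≤count (λ w → G w v) uv))

  sink-¬Arc : ∀ {u v} → IsSink u → ¬ Arc G u v
  sink-¬Arc {u} sink uv = <-irrefl refl (subst (1 ≤_) sink (T⇒1≤count (G u) uv))

  reach-root : ∀ {u v} → IsRoot G v → Reach G u v → u ≡ v
  reach-root root ε = refl
  reach-root root (uw ◅ wv) with reach-root root wv
  ... | refl = ⊥-elim (Arc⇒nonroot uw root)

  reach-sink : ∀ {u v} → IsSink u → Reach G u v → u ≡ v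
  reach-sink sink ε         = refl
  reach-sink sink (uw ◅ _) = ⊥-elim (sink-¬Arc sink uw)

  reaches-sink : ∀ v → ∃ λ l → Reach G v l × IsSink l
  reaches-sink v = go v (descendants-wellFounded v)
    where
    go : ∀ v → Acc ProperDescendant v → ∃ λ l → Reach G v l × IsSink l
    go v (acc rs) with outdeg G v ≟ℕ 0
    ... | yes sink = v , ε , sink
    ... | no ¬sink with 1≤count⇒∃T (G v) (n≢0⇒n>0 ¬sink)
    ...   | c , vc with go c (rs (c , vc , ε))
    ...     | l , cl , sink = l , vc ◅ cl , sink

  root-reach-sink⇒child : ∀ {w x} → IsRoot G w → Reach G w x → IsSink x →
    ∃ λ c → Arc G w c × Reach G c x
  root-reach-sink⇒child {w} root ε sink with subst (2 ≤_) sink (rootOut w root)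
  ... | ()
  root-reach-sink⇒child root (wc ◅ cx) _ = _ , wc , cx

  sinks-AAdj : ∀ {w x y} → IsSink x → IsSink y → x ≢ y → Reach G w x → Reach G w y → AAdj G x y
  sinks-AAdj {x = x} {y} sx sy x≢y wx wy =
    (sinkIsLeaf x sx , sx) , (sinkIsLeaf y sy , sy) , x≢y , _ , wx , wy

  module Tree (treelike : ¬ HasCycle (UAdj G)) where

    reach⇒walk : ∀ {v s t} → Reach G s t → ¬ Reach G s v → Star (Avoiding (UAdj G) v) s t
    reach⇒walk ε         _   = ε
    reach⇒walk (sr ◅ rt) s↛v =
      (inj₁ sr , (λ { refl → s↛v ε }) , (λ { refl → s↛v (sr ◅ ε) }))
        ◅ reach⇒walk rt (s↛v ∘ (sr ◅_))

    reach⇒walk⁻¹ : ∀ {v s t} → Reach G s t → ¬ Reach G s v → Star (Avoiding (UAdj G) v) t s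
    reach⇒walk⁻¹ st s↛v =
      reverse (λ { (uv , u≢ , v≢) → ⊎-swap uv , v≢ , u≢ }) (reach⇒walk st s↛v)

    distinct-children-disjoint : ∀ {v c c′ l l′} → Arc G v c → Arc G v c′ → c ≢ c′ →
      Reach G c l → Reach G c′ l′ → l ≢ l′
    distinct-children-disjoint vc vc′ c≢c′ cl c′l refl =
      treelike (cycle-through (inj₁ vc) (inj₂ vc′) c≢c′ (Arc⇒≢ vc)
        (reach⇒walk cl (acyclic _ _ vc) ◅◅ reach⇒walk⁻¹ c′l (acyclic _ _ vc′)))

    3≤outdeg⇒A-cycle : ∀ {v} → 3 ≤ outdeg G v → HasCycle (AAdj G)
    3≤outdeg⇒A-cycle {v} 3≤out with 3≤count⇒∃-distinct (G v) 3≤out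
    ... | c₁ , c₂ , c₃ , vc₁ , vc₂ , vc₃ , c₁≢c₂ , c₁≢c₃ , c₂≢c₃
      with reaches-sink c₁ | reaches-sink c₂ | reaches-sink c₃
    ... | l₁ , c₁l₁ , s₁ | l₂ , c₂l₂ , s₂ | l₃ , c₃l₃ , s₃ =
      triangle (sinks-AAdj s₁ s₂ l₁≢l₂ vl₁ vl₂) (sinks-AAdj s₂ s₃ l₂≢l₃ vl₂ vl₃)
               (sinks-AAdj s₃ s₁ (l₁≢l₃ ∘ sym) vl₃ vl₁) l₁≢l₂ l₁≢l₃ l₂≢l₃
      where
      vl₁ = vc₁ ◅ c₁l₁
      vl₂ = vc₂ ◅ c₂l₂
      vl₃ = vc₃ ◅ c₃l₃
      l₁≢l₂ = distinct-children-disjoint vc₁ vc₂ c₁≢c₂ c₁l₁ c₂l₂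
      l₁≢l₃ = distinct-children-disjoint vc₁ vc₃ c₁≢c₃ c₁l₁ c₃l₃
      l₂≢l₃ = distinct-children-disjoint vc₂ vc₃ c₂≢c₃ c₂l₂ c₃l₃

    branching-ancestor : ∀ {p q v} → Acc (flip ProperDescendant) p → Arc G p q → Reach G q v →
      ∃₂ λ w l → Reach G w v × Reach G w l × IsSink l × ¬ Reach G v l
    branching-ancestor {p} (acc rs) pq qv with 2 ≤? outdeg G p
    ... | yes 2≤out with 2≤count⇒∃-other (G p) pq 2≤out
    ...   | c , pc , c≢q with reaches-sink c
    ...     | l , cl , sink =
      p , l , pq ◅ qv , pc ◅ cl , sink , λ vl → distinct-children-disjoint pc pq c≢q cl (qv ◅◅ vl) refl
    branching-ancestor {p} (acc rs) pq qv | no 2≰out with indeg G p ≟ℕ 0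
    ... | yes root = ⊥-elim (2≰out (rootOut p root))
    ... | no nonroot with 1≤count⇒∃T (λ u → G u p) (n≢0⇒n>0 nonroot)
    ...   | p′ , p′p = branching-ancestor (rs (p , p′p , ε)) p′p (pq ◅ qv)

    nonroot-2≤outdeg⇒A-cycle : ∀ {v} → ¬ IsRoot G v → 2 ≤ outdeg G v → HasCycle (AAdj G)
    nonroot-2≤outdeg⇒A-cycle {v} nonroot 2≤out
      with 2≤count⇒∃-distinct (G v) 2≤out | 1≤count⇒∃T (λ u → G u v) (n≢0⇒n>0 nonroot)
    ... | c₁ , c₂ , vc₁ , vc₂ , c₁≢c₂ | p , pv
      with reaches-sink c₁ | reaches-sink c₂ | branching-ancestor (ancestors-wellFounded p) pv ε
    ... | l₁ , c₁l₁ , s₁ | l₂ , c₂l₂ , s₂ | w , l₃ , wv , wl₃ , s₃ , v↛l₃ =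
      triangle (sinks-AAdj s₁ s₂ l₁≢l₂ vl₁ vl₂) (sinks-AAdj s₂ s₃ l₂≢l₃ (wv ◅◅ vl₂) wl₃)
               (sinks-AAdj s₃ s₁ (l₁≢l₃ ∘ sym) wl₃ (wv ◅◅ vl₁)) l₁≢l₂ l₁≢l₃ l₂≢l₃
      where
      vl₁ = vc₁ ◅ c₁l₁
      vl₂ = vc₂ ◅ c₂l₂
      l₁≢l₂ = distinct-children-disjoint vc₁ vc₂ c₁≢c₂ c₁l₁ c₂l₂
      l₁≢l₃ : l₁ ≢ l₃
      l₁≢l₃ e = v↛l₃ (subst (Reach G v) e vl₁)
      l₂≢l₃ : l₂ ≢ l₃
      l₂≢l₃ e = v↛l₃ (subst (Reach G v) e vl₂)

    module BranchingAtRoots (outdeg≤2 : ∀ v → outdeg G v ≤ 2)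
                            (outdeg≡2⇒root : ∀ v → outdeg G v ≡ 2 → IsRoot G v) where

      nonroot⇒outdeg≤1 : ∀ {v} → ¬ IsRoot G v → outdeg G v ≤ 1
      nonroot⇒outdeg≤1 {v} nonroot with outdeg G v ≤? 1
      ... | yes out≤1 = out≤1
      ... | no  out≰1 = ⊥-elim (nonroot (outdeg≡2⇒root v (≤-antisym (outdeg≤2 v) (≰⇒> out≰1))))

      nonroot-unique-sink : ∀ {w x y} → ¬ IsRoot G w → Reach G w x → Reach G w y →
        IsSink x → IsSink y → x ≡ y
      nonroot-unique-sink _ ε        wy sx _  = reach-sink sx wy
      nonroot-unique-sink _ (wc ◅ _) ε  _  sy = ⊥-elim (sink-¬Arc sy wc)
      nonroot-unique-sink {w} nonroot (_◅_ {j = c} wc cx) (_◅_ {j = c′} wc′ c′y) sx sy with c ≟ c′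
      ... | yes refl = nonroot-unique-sink (Arc⇒nonroot wc) cx c′y sx sy
      ... | no  c≢c′ =
        ⊥-elim (<-irrefl refl (≤-trans (distinct-T⇒2≤count (G w) wc wc′ c≢c′) (nonroot⇒outdeg≤1 nonroot)))

      distinct-sinks⇒distinct-children : ∀ {u c c′ x y} → Arc G u c → Reach G c x → Reach G c′ y →
        IsSink x → IsSink y → x ≢ y → c ≢ c′
      distinct-sinks⇒distinct-children uc cx c′y sx sy x≢y refl =
        x≢y (nonroot-unique-sink (Arc⇒nonroot uc) cx c′y sx sy)

      root-no-third-sink : ∀ {w x y z} → IsRoot G w → Reach G w x → Reach G w y →
        IsSink x → IsSink y → x ≢ y → x ≢ z → y ≢ z → IsSink z → ¬ Reach G w z
      root-no-third-sink {w} root wx wy sx sy x≢y x≢z y≢z sz wz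
        with root-reach-sink⇒child root wx sx | root-reach-sink⇒child root wy sy
           | root-reach-sink⇒child root wz sz
      ... | cx , wcx , cxx | cy , wcy , cyy | cz , wcz , czz =
        <-irrefl refl (≤-trans (distinct-T⇒3≤count (G w) wcx wcy wcz
          (distinct-sinks⇒distinct-children wcx cxx cyy sx sy x≢y)
          (distinct-sinks⇒distinct-children wcx cxx czz sx sz x≢z)
          (distinct-sinks⇒distinct-children wcy cyy czz sy sz y≢z)) (outdeg≤2 w))

      root-walk⇒cycle : ∀ {w x y} → IsRoot G w → Reach G w x → Reach G w y →
        IsSink x → IsSink y → x ≢ y → Star (Avoiding (UAdj G) w) y x → HasCycle (UAdj G)
      root-walk⇒cycle root wx wy sx sy x≢y yx
        with root-reach-sink⇒child root wx sx | root-reach-sink⇒child root wy sy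
      ... | cx , wcx , cxx | cy , wcy , cyy =
        cycle-through (inj₁ wcy) (inj₂ wcx)
          (distinct-sinks⇒distinct-children wcy cyy cxx sy sx (x≢y ∘ sym)) (Arc⇒≢ wcy)
          (reach⇒walk cyy (acyclic _ _ wcy) ◅◅ yx ◅◅ reach⇒walk⁻¹ cxx (acyclic _ _ wcx))

      AAdj⇒walk : ∀ {w p q} → IsRoot G w → AAdj G p q →
        (IsSink p → ¬ Reach G w p) ⊎ (IsSink q → ¬ Reach G w q) → Star (Avoiding (UAdj G) w) p q
      AAdj⇒walk {w} root ((_ , sp) , (_ , sq) , _ , w′ , w′p , w′q) escapes with w′ ≟ w | escapes
      ... | yes refl | inj₁ p-escapes = ⊥-elim (p-escapes sp w′p)
      ... | yes refl | inj₂ q-escapes = ⊥-elim (q-escapes sq w′q)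
      ... | no  w′≢w | _              = reach⇒walk⁻¹ w′p w′↛w ◅◅ reach⇒walk w′q w′↛w
        where
        w′↛w : ¬ Reach G w′ w
        w′↛w = w′≢w ∘ reach-root root

      ¬A-cycle : ¬ HasCycle (AAdj G)
      ¬A-cycle (_ , []          , () , _)
      ¬A-cycle (_ , _ ∷ []      , s≤s () , _)
      ¬A-cycle (x₀ , x₁ ∷ z ∷ zs , _ , (_ ∷ x₀∉) ∷ x₁∉ ∷ _ ,
                ((_ , s₀) , (_ , s₁) , x₀≢x₁ , w , wx₀ , wx₁) ∷ x₁z ∷ z↝x₀)
        with indeg G w ≟ℕ 0
      ... | no  nonroot = x₀≢x₁ (nonroot-unique-sink nonroot wx₀ wx₁ s₀ s₁)
      ... | yes root    = treelike (root-walk⇒cycle root wx₀ wx₁ s₀ s₁ x₀≢x₁ x₁↝x₀)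
        where
        escapes : All (λ z → IsSink z → ¬ Reach G w z) (z ∷ zs)
        escapes = All.zipWith (uncurry (root-no-third-sink root wx₀ wx₁ s₀ s₁ x₀≢x₁)) (x₀∉ , x₁∉)

        x₁↝x₀ : Star (Avoiding (UAdj G) w) x₁ x₀
        x₁↝x₀ = AAdj⇒walk root x₁z (inj₂ (All.head escapes))
             ◅◅ linked⇒star (λ esc pq → AAdj⇒walk root pq (inj₁ esc)) zs escapes z↝x₀

lemma6p2 : (n : ℕ) (G : Digraph n) → IsArboreal G →
    (¬ HasCycle (AAdj G)) ⇔
      ((∀ v → outdeg G v ≤ 2) × (∀ v → outdeg G v ≡ 2 → IsRoot G v))
lemma6p2 n G (network , _ , treelike) = mk⇔
  (λ ¬A-cycle →
      (λ v → decidable-stable (outdeg G v ≤? 2) λ out≰2 →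
               ¬A-cycle (3≤outdeg⇒A-cycle (≰⇒> out≰2)))
    , (λ v out≡2 → decidable-stable (indeg G v ≟ℕ 0) λ nonroot →
               ¬A-cycle (nonroot-2≤outdeg⇒A-cycle nonroot (≤-reflexive (sym out≡2)))))
  (λ (outdeg≤2 , outdeg≡2⇒root) → BranchingAtRoots.¬A-cycle outdeg≤2 outdeg≡2⇒root)
  where
  open Network G network
  open Tree treelike
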